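{- Let $G$ be a finite group which is not an elementary abelian $2$-group. Let $\Gamma(G)\leq\operatorname{Sym}(G)$ be the group generated by all $\lambda_g$, $\rho_g$ ($g\in G$) and $\iota$. Then $\Gamma(G)\cong (G\wr C_2)/Z$, where $Z=\{(z,z)\in G\times G\mid z\in Z(G)\}$.
   Context: For $g\in G$, $\lambda_g\in\operatorname{Sym}(G)$ is $x\mapsto gx$, $\rho_g$ is $x\mapsto xg^{ -1}$, and $\iota$ is $x\mapsto x^{ -1}$. The wreath product $G\wr C_2$ is the semidirect product $(G\times G)\rtimes\langle s\rangle$ with $s$ of order $2$ acting by $(g,h)^s=(h,g)$. $Z(G)$ is the center of $G$. -}

module Defs where

open import Level using (Level; _⊔_)
open import Algebra.Bundles using (Group)
open import Algebra.Bundles.Raw using (RawGroup)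
open import Data.Nat using (ℕ)
open import Data.Fin using (Fin)
open import Data.Bool using (Bool; true; false; _xor_)
open import Data.Product using (Σ; _×_; _,_; ∃)
open import Relation.Binary.PropositionalEquality using (_≡_)
open import Relation.Nullary using (¬_)
import Algebra.Properties.Group as GP

module _ {c ℓ : Level} (G : Group c ℓ) where
  open Group G

  record Finite : Set (c ⊔ ℓ) where
    field
      size      : ℕ
      enum      : Fin size → Carrier
      index     : Carrier → Fin size
      enum-index : ∀ x → enum (index x) ≈ x
      index-enum : ∀ i → index (enum i) ≡ i

  IsElementaryAbelian2 : Set (c ⊔ ℓ)
  IsElementaryAbelian2 = (∀ x y → x ∙ y ≈ y ∙ x) × (∀ x → x ∙ x ≈ ε)

  Central : Carrier → Set (c ⊔ ℓ)
  Central z = ∀ w → z ∙ w ≈ w ∙ z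

  record Perm : Set (c ⊔ ℓ) where
    field
      to       : Carrier → Carrier
      from     : Carrier → Carrier
      to-cong   : ∀ {x y} → x ≈ y → to x ≈ to y
      from-cong : ∀ {x y} → x ≈ y → from x ≈ from y
      to-from  : ∀ x → to (from x) ≈ x
      from-to  : ∀ x → from (to x) ≈ x
  open Perm public

  _≈ₚ_ : Perm → Perm → Set (c ⊔ ℓ)
  σ ≈ₚ τ = ∀ x → to σ x ≈ to τ x

  _∘ₚ_ : Perm → Perm → Perm
  σ ∘ₚ τ = record
    { to = λ x → to σ (to τ x)
    ; from = λ x → from τ (from σ x)
    ; to-cong = λ p → to-cong σ (to-cong τ p)
    ; from-cong = λ p → from-cong τ (from-cong σ p)
    ; to-from = λ x → trans (to-cong σ (to-from τ (from σ x))) (to-from σ x)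
    ; from-to = λ x → trans (from-cong τ (from-to σ (to τ x))) (from-to τ x)
    }

  idₚ : Perm
  idₚ = record { to = λ x → x ; from = λ x → x ; to-cong = λ p → p
               ; from-cong = λ p → p ; to-from = λ _ → refl ; from-to = λ _ → refl }

  invₚ : Perm → Perm
  invₚ σ = record { to = from σ ; from = to σ ; to-cong = from-cong σ
                  ; from-cong = to-cong σ ; to-from = from-to σ ; from-to = to-from σ }

  private
    cancel₁ : ∀ a x → a ∙ (a ⁻¹ ∙ x) ≈ x
    cancel₁ a x = trans (sym (assoc _ _ _)) (trans (∙-congʳ (inverseʳ a)) (identityˡ x))
    cancel₂ : ∀ a x → a ⁻¹ ∙ (a ∙ x) ≈ x
    cancel₂ a x = trans (sym (assoc _ _ _)) (trans (∙-congʳ (inverseˡ a)) (identityˡ x))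
    cancel₃ : ∀ a x → (x ∙ a) ∙ a ⁻¹ ≈ x
    cancel₃ a x = trans (assoc _ _ _) (trans (∙-congˡ (inverseʳ a)) (identityʳ x))
    cancel₄ : ∀ a x → (x ∙ a ⁻¹) ∙ a ≈ x
    cancel₄ a x = trans (assoc _ _ _) (trans (∙-congˡ (inverseˡ a)) (identityʳ x))

  λₚ : Carrier → Perm
  λₚ g = record { to = λ x → g ∙ x ; from = λ x → g ⁻¹ ∙ x
                ; to-cong = ∙-congˡ ; from-cong = ∙-congˡ
                ; to-from = cancel₁ g ; from-to = cancel₂ g }

  ρₚ : Carrier → Perm
  ρₚ g = record { to = λ x → x ∙ g ⁻¹ ; from = λ x → x ∙ g
                ; to-cong = ∙-congʳ ; from-cong = ∙-congʳ
                ; to-from = cancel₃ g ; from-to = cancel₄ g }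

  ιₚ : Perm
  ιₚ = record { to = _⁻¹ ; from = _⁻¹ ; to-cong = ⁻¹-cong ; from-cong = ⁻¹-cong
              ; to-from = GP.⁻¹-involutive G ; from-to = GP.⁻¹-involutive G }

  data InΓ : Perm → Set (c ⊔ ℓ) where
    gen-λ : ∀ g → InΓ (λₚ g)
    gen-ρ : ∀ g → InΓ (ρₚ g)
    gen-ι : InΓ ιₚ
    gen-id : InΓ idₚ
    gen-∘ : ∀ {σ τ} → InΓ σ → InΓ τ → InΓ (σ ∘ₚ τ)
    gen-inv : ∀ {σ} → InΓ σ → InΓ (invₚ σ)
    gen-≈ : ∀ {σ τ} → σ ≈ₚ τ → InΓ σ → InΓ τ

  Γ : RawGroup (c ⊔ ℓ) (c ⊔ ℓ)
  Γ = record
    { Carrier = Σ Perm InΓ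
    ; _≈_ = λ { (σ , _) (τ , _) → σ ≈ₚ τ }
    ; _∙_ = λ { (σ , p) (τ , q) → (σ ∘ₚ τ , gen-∘ p q) }
    ; ε = (idₚ , gen-id)
    ; _⁻¹ = λ { (σ , p) → (invₚ σ , gen-inv p) }
    }

  -- G ≀ C₂ = (G × G) ⋊ ⟨s⟩, elements ((g , h) , b) with b = true meaning s;
  -- s acts by (g , h)^s = (h , g)
  W : Set c
  W = (Carrier × Carrier) × Bool

  swap? : Bool → Carrier × Carrier → Carrier × Carrier
  swap? false (g , h) = (g , h)
  swap? true  (g , h) = (h , g)

  _≈W_ : W → W → Set ℓ
  ((a , b) , s) ≈W ((a' , b') , s') = (a ≈ a' × b ≈ b') × s ≡ s'

  _∙W_ : W → W → W
  ((a , b) , s) ∙W (gh , t) with swap? s gh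
  ... | (g' , h') = ((a ∙ g' , b ∙ h') , s xor t)

  εW : W
  εW = ((ε , ε) , false)

  _⁻¹W : W → W
  ((a , b) , s) ⁻¹W = (swap? s (a ⁻¹ , b ⁻¹) , s)

  InZ : W → Set (c ⊔ ℓ)
  InZ w = ∃ λ z → Central z × (w ≈W ((z , z) , false))

  WreathModZ : RawGroup c (c ⊔ ℓ)
  WreathModZ = record
    { Carrier = W
    ; _≈_ = λ x y → InZ ((x ⁻¹W) ∙W y)
    ; _∙_ = _∙W_
    ; ε = εW
    ; _⁻¹ = _⁻¹W
    }

module Submission where

-- The wreath product W = (G × G) ⋊ ⟨s⟩ acts on G through
--     act ((a , b) , s) = λ_a ∘ ρ_b ∘ ι^s ,   i.e.  x ↦ a · x^(±1) · b⁻¹ .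
-- We show
--   * act is a homomorphism W → Sym(G) (act-∙, act-⁻¹), by direct computation;
--   * its kernel is exactly Z = {(z , z) ∣ z ∈ Z(G)}: an untwisted element
--     x ↦ a x b⁻¹ is trivial iff a = b is central, while a twisted element
--     x ↦ a x⁻¹ b⁻¹ can only be trivial if inversion is an inner automorphism,
--     which forces G to be an elementary abelian 2-group (⁻¹-inner⇒EA2);
--   * the image of act is Γ(G): it contains the generators and, by induction on
--     the generation of Γ(G), every member of Γ(G) has an explicit preimage
--     (decode, act-decode).
-- The isomorphism Γ(G) → W/Z is then σ ↦ decode σ, and the group laws,
-- injectivity and surjectivity all reduce to "act u ≈ act v iff u⁻¹v ∈ Z".

open import Defs
open import Level using (Level)
open import Algebra.Bundles using (Group)
open import Algebra.Morphism.Structures using (module GroupMorphisms)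
open import Data.Product using (Σ; ∃; _,_)
open import Data.Bool using (true; false)
open import Data.Empty using (⊥-elim)
open import Function using (_∘′_)
open import Relation.Nullary using (¬_)
import Relation.Binary.PropositionalEquality as PE
import Algebra.Properties.Group as GroupProperties
import Algebra.Properties.Monoid as MonoidProperties
import Relation.Binary.Reasoning.Setoid as SetoidReasoning

module WreathAction {c ℓ : Level} (G : Group c ℓ) where
  open Group G
  open GroupProperties G
  open MonoidProperties monoid using (cancelˡ; cancelʳ)
  open SetoidReasoning setoid

  conj-∙ : ∀ a x y → a ∙ ((x ∙ y) ∙ a ⁻¹) ≈ (a ∙ (x ∙ a ⁻¹)) ∙ (a ∙ (y ∙ a ⁻¹))
  conj-∙ a x y = begin
    a ∙ ((x ∙ y) ∙ a ⁻¹)                 ≈⟨ ∙-congˡ (assoc _ _ _) ⟩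
    a ∙ (x ∙ (y ∙ a ⁻¹))                 ≈⟨ ∙-congˡ (∙-congˡ (sym (cancelˡ (inverseˡ a) _))) ⟩
    a ∙ (x ∙ (a ⁻¹ ∙ (a ∙ (y ∙ a ⁻¹))))  ≈⟨ ∙-congˡ (sym (assoc _ _ _)) ⟩
    a ∙ ((x ∙ a ⁻¹) ∙ (a ∙ (y ∙ a ⁻¹)))  ≈⟨ sym (assoc _ _ _) ⟩
    (a ∙ (x ∙ a ⁻¹)) ∙ (a ∙ (y ∙ a ⁻¹))  ∎

  -- If inversion is multiplicative, then (being also anti-multiplicative)
  -- G is abelian.
  ⁻¹-homo⇒comm : (∀ x y → (x ∙ y) ⁻¹ ≈ x ⁻¹ ∙ y ⁻¹) → ∀ x y → x ∙ y ≈ y ∙ x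
  ⁻¹-homo⇒comm homo x y = begin
    x ∙ y                  ≈⟨ sym (∙-cong (⁻¹-involutive x) (⁻¹-involutive y)) ⟩
    x ⁻¹ ⁻¹ ∙ y ⁻¹ ⁻¹      ≈⟨ sym (homo (x ⁻¹) (y ⁻¹)) ⟩
    (x ⁻¹ ∙ y ⁻¹) ⁻¹       ≈⟨ ⁻¹-anti-homo-∙ (x ⁻¹) (y ⁻¹) ⟩
    y ⁻¹ ⁻¹ ∙ x ⁻¹ ⁻¹      ≈⟨ ∙-cong (⁻¹-involutive y) (⁻¹-involutive x) ⟩
    y ∙ x                  ∎

  -- If inversion is an inner automorphism x ↦ a x a⁻¹, then G is abelian,
  -- hence inversion is the identity: G is an elementary abelian 2-group.
  ⁻¹-inner⇒EA2 : ∀ a → (∀ x → x ⁻¹ ≈ a ∙ (x ∙ a ⁻¹)) → IsElementaryAbelian2 G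
  ⁻¹-inner⇒EA2 a inner = comm , square
    where
    comm : ∀ x y → x ∙ y ≈ y ∙ x
    comm = ⁻¹-homo⇒comm λ x y →
      trans (inner (x ∙ y)) (trans (conj-∙ a x y) (sym (∙-cong (inner x) (inner y))))
    ⁻¹-trivial : ∀ x → x ⁻¹ ≈ x
    ⁻¹-trivial x = begin
      x ⁻¹             ≈⟨ inner x ⟩
      a ∙ (x ∙ a ⁻¹)   ≈⟨ ∙-congˡ (comm x (a ⁻¹)) ⟩
      a ∙ (a ⁻¹ ∙ x)   ≈⟨ cancelˡ (inverseʳ a) x ⟩
      x                ∎
    square : ∀ x → x ∙ x ≈ ε
    square x = trans (∙-congˡ (sym (⁻¹-trivial x))) (inverseʳ x)

  from-resp-≈ₚ : ∀ σ τ → _≈ₚ_ G σ τ → ∀ x → from σ x ≈ from τ x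
  from-resp-≈ₚ σ τ σ≈τ x = begin
    from σ x                  ≈⟨ sym (from-to τ (from σ x)) ⟩
    from τ (to τ (from σ x))  ≈⟨ from-cong τ (sym (σ≈τ (from σ x))) ⟩
    from τ (to σ (from σ x))  ≈⟨ from-cong τ (to-from σ x) ⟩
    from τ x                  ∎

  act : W G → Perm G
  act ((a , b) , false) = _∘ₚ_ G (λₚ G a) (ρₚ G b)
  act ((a , b) , true)  = _∘ₚ_ G (_∘ₚ_ G (λₚ G a) (ρₚ G b)) (ιₚ G)

  untwisted-∘ : ∀ a b c d y →
                (a ∙ c) ∙ (y ∙ (b ∙ d) ⁻¹) ≈ a ∙ ((c ∙ (y ∙ d ⁻¹)) ∙ b ⁻¹)
  untwisted-∘ a b c d y = begin
    (a ∙ c) ∙ (y ∙ (b ∙ d) ⁻¹)      ≈⟨ ∙-congˡ (∙-congˡ (⁻¹-anti-homo-∙ b d)) ⟩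
    (a ∙ c) ∙ (y ∙ (d ⁻¹ ∙ b ⁻¹))   ≈⟨ assoc _ _ _ ⟩
    a ∙ (c ∙ (y ∙ (d ⁻¹ ∙ b ⁻¹)))   ≈⟨ ∙-congˡ (∙-congˡ (sym (assoc _ _ _))) ⟩
    a ∙ (c ∙ ((y ∙ d ⁻¹) ∙ b ⁻¹))   ≈⟨ ∙-congˡ (sym (assoc _ _ _)) ⟩
    a ∙ ((c ∙ (y ∙ d ⁻¹)) ∙ b ⁻¹)   ∎

  -- λ_a ρ_b ι ∘ λ_c ρ_d = λ_(ad) ρ_(bc) ι, evaluated at y
  -- (ι swaps the roles of left and right translations).
  twisted-∘ : ∀ a b c d y →
              (a ∙ d) ∙ (y ⁻¹ ∙ (b ∙ c) ⁻¹) ≈ a ∙ ((c ∙ (y ∙ d ⁻¹)) ⁻¹ ∙ b ⁻¹)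
  twisted-∘ a b c d y = begin
    (a ∙ d) ∙ (y ⁻¹ ∙ (b ∙ c) ⁻¹)          ≈⟨ ∙-congˡ (∙-congˡ (⁻¹-anti-homo-∙ b c)) ⟩
    (a ∙ d) ∙ (y ⁻¹ ∙ (c ⁻¹ ∙ b ⁻¹))       ≈⟨ assoc _ _ _ ⟩
    a ∙ (d ∙ (y ⁻¹ ∙ (c ⁻¹ ∙ b ⁻¹)))       ≈⟨ ∙-congˡ (sym (assoc _ _ _)) ⟩
    a ∙ ((d ∙ y ⁻¹) ∙ (c ⁻¹ ∙ b ⁻¹))       ≈⟨ ∙-congˡ (sym (assoc _ _ _)) ⟩
    a ∙ (((d ∙ y ⁻¹) ∙ c ⁻¹) ∙ b ⁻¹)       ≈⟨ ∙-congˡ (∙-congʳ (∙-congʳ (∙-congʳ (sym (⁻¹-involutive d))))) ⟩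
    a ∙ (((d ⁻¹ ⁻¹ ∙ y ⁻¹) ∙ c ⁻¹) ∙ b ⁻¹) ≈⟨ ∙-congˡ (∙-congʳ (∙-congʳ (sym (⁻¹-anti-homo-∙ y (d ⁻¹))))) ⟩
    a ∙ (((y ∙ d ⁻¹) ⁻¹ ∙ c ⁻¹) ∙ b ⁻¹)    ≈⟨ ∙-congˡ (∙-congʳ (sym (⁻¹-anti-homo-∙ c (y ∙ d ⁻¹)))) ⟩
    a ∙ ((c ∙ (y ∙ d ⁻¹)) ⁻¹ ∙ b ⁻¹)       ∎

  act-∙ : ∀ u v x → to (act (_∙W_ G u v)) x ≈ to (act u) (to (act v) x)
  act-∙ ((a , b) , false) ((c , d) , false) x = untwisted-∘ a b c d x
  act-∙ ((a , b) , false) ((c , d) , true)  x = untwisted-∘ a b c d (x ⁻¹)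
  act-∙ ((a , b) , true)  ((c , d) , false) x = twisted-∘ a b c d x
  act-∙ ((a , b) , true)  ((c , d) , true)  x =
    trans (∙-congˡ (∙-congʳ (sym (⁻¹-involutive x)))) (twisted-∘ a b c d (x ⁻¹))

  act-⁻¹ : ∀ u x → to (act (_⁻¹W G u)) x ≈ from (act u) x
  act-⁻¹ ((a , b) , false) x = begin
    a ⁻¹ ∙ (x ∙ b ⁻¹ ⁻¹)  ≈⟨ ∙-congˡ (∙-congˡ (⁻¹-involutive b)) ⟩
    a ⁻¹ ∙ (x ∙ b)        ≈⟨ sym (assoc _ _ _) ⟩
    (a ⁻¹ ∙ x) ∙ b        ∎
  act-⁻¹ ((a , b) , true) x = begin
    b ⁻¹ ∙ (x ⁻¹ ∙ a ⁻¹ ⁻¹)  ≈⟨ sym (assoc _ _ _) ⟩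
    (b ⁻¹ ∙ x ⁻¹) ∙ a ⁻¹ ⁻¹  ≈⟨ ∙-congʳ (sym (⁻¹-anti-homo-∙ x b)) ⟩
    (x ∙ b) ⁻¹ ∙ a ⁻¹ ⁻¹     ≈⟨ sym (⁻¹-anti-homo-∙ (a ⁻¹) (x ∙ b)) ⟩
    (a ⁻¹ ∙ (x ∙ b)) ⁻¹      ≈⟨ ⁻¹-cong (sym (assoc _ _ _)) ⟩
    ((a ⁻¹ ∙ x) ∙ b) ⁻¹      ∎

  Z⇒trivial : ∀ w → InZ G w → ∀ x → to (act w) x ≈ x
  Z⇒trivial ((a , b) , false) (z , central , (a≈z , b≈z) , _) x = begin
    a ∙ (x ∙ b ⁻¹)   ≈⟨ ∙-cong a≈z (∙-congˡ (⁻¹-cong b≈z)) ⟩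
    z ∙ (x ∙ z ⁻¹)   ≈⟨ sym (assoc _ _ _) ⟩
    (z ∙ x) ∙ z ⁻¹   ≈⟨ ∙-congʳ (central x) ⟩
    (x ∙ z) ∙ z ⁻¹   ≈⟨ cancelʳ (inverseʳ z) x ⟩
    x                ∎
  Z⇒trivial ((a , b) , true) (_ , _ , _ , ())

  -- If x ↦ a x b⁻¹ is the identity, then a = b (take x = ε) and a is central.
  trivial-translation⇒Z : ∀ a b → (∀ x → a ∙ (x ∙ b ⁻¹) ≈ x) →
                          InZ G ((a , b) , false)
  trivial-translation⇒Z a b trivial = a , central , (refl , sym a≈b) , PE.refl
    where
    a≈b : a ≈ b
    a≈b = x∙y⁻¹≈ε⇒x≈y a b (trans (∙-congˡ (sym (identityˡ _))) (trivial ε))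
    central : Central G a
    central w = begin
      a ∙ w                  ≈⟨ sym (cancelʳ (inverseˡ b) _) ⟩
      ((a ∙ w) ∙ b ⁻¹) ∙ b   ≈⟨ ∙-congʳ (assoc _ _ _) ⟩
      (a ∙ (w ∙ b ⁻¹)) ∙ b   ≈⟨ ∙-congʳ (trivial w) ⟩
      w ∙ b                  ≈⟨ ∙-congˡ (sym a≈b) ⟩
      w ∙ a                  ∎

  -- If x ↦ a x⁻¹ b⁻¹ is the identity, then b⁻¹ = a⁻¹ (take x = ε), so
  -- inversion is conjugation by a and G is an elementary abelian 2-group.
  trivial-twist⇒EA2 : ∀ a b → (∀ x → a ∙ (x ⁻¹ ∙ b ⁻¹) ≈ x) → IsElementaryAbelian2 G
  trivial-twist⇒EA2 a b trivial = ⁻¹-inner⇒EA2 a inner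
    where
    b⁻¹≈a⁻¹ : b ⁻¹ ≈ a ⁻¹
    b⁻¹≈a⁻¹ = inverseʳ-unique a (b ⁻¹)
      (trans (∙-congˡ (sym (trans (∙-congʳ ε⁻¹≈ε) (identityˡ _)))) (trivial ε))
    inner : ∀ x → x ⁻¹ ≈ a ∙ (x ∙ a ⁻¹)
    inner x = sym (trans (∙-congˡ (∙-cong (sym (⁻¹-involutive x)) (sym b⁻¹≈a⁻¹)))
                         (trivial (x ⁻¹)))

  trivial⇒Z : ¬ IsElementaryAbelian2 G → ∀ w → (∀ x → to (act w) x ≈ x) → InZ G w
  trivial⇒Z _   ((a , b) , false) = trivial-translation⇒Z a b
  trivial⇒Z ¬EA ((a , b) , true)  = ⊥-elim ∘′ (¬EA ∘′ trivial-twist⇒EA2 a b)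

  same-action⇒Z : ¬ IsElementaryAbelian2 G →
                  ∀ u v → _≈ₚ_ G (act u) (act v) → InZ G (_∙W_ G (_⁻¹W G u) v)
  same-action⇒Z ¬EA u v u≈v = trivial⇒Z ¬EA (_∙W_ G (_⁻¹W G u) v) λ x → begin
    to (act (_∙W_ G (_⁻¹W G u) v)) x     ≈⟨ act-∙ (_⁻¹W G u) v x ⟩
    to (act (_⁻¹W G u)) (to (act v) x)   ≈⟨ act-⁻¹ u (to (act v) x) ⟩
    from (act u) (to (act v) x)          ≈⟨ from-cong (act u) (sym (u≈v x)) ⟩
    from (act u) (to (act u) x)          ≈⟨ from-to (act u) x ⟩
    x                                    ∎

  Z⇒same-action : ∀ u v → InZ G (_∙W_ G (_⁻¹W G u) v) → _≈ₚ_ G (act u) (act v)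
  Z⇒same-action u v z x = sym (begin
    to (act v) x                                      ≈⟨ sym (to-from (act u) _) ⟩
    to (act u) (from (act u) (to (act v) x))          ≈⟨ to-cong (act u) (sym (act-⁻¹ u _)) ⟩
    to (act u) (to (act (_⁻¹W G u)) (to (act v) x))   ≈⟨ to-cong (act u) (sym (act-∙ (_⁻¹W G u) v x)) ⟩
    to (act u) (to (act (_∙W_ G (_⁻¹W G u) v)) x)     ≈⟨ to-cong (act u) (Z⇒trivial _ z x) ⟩
    to (act u) x                                      ∎)

  act-InΓ : ∀ w → InΓ G (act w)
  act-InΓ ((a , b) , false) = gen-∘ (gen-λ a) (gen-ρ b)
  act-InΓ ((a , b) , true)  = gen-∘ (gen-∘ (gen-λ a) (gen-ρ b)) gen-ι

  decode : ∀ {σ} → InΓ G σ → W G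
  decode (gen-λ g)     = ((g , ε) , false)
  decode (gen-ρ g)     = ((ε , g) , false)
  decode gen-ι         = ((ε , ε) , true)
  decode gen-id        = ((ε , ε) , false)
  decode (gen-∘ p q)   = _∙W_ G (decode p) (decode q)
  decode (gen-inv p)   = _⁻¹W G (decode p)
  decode (gen-≈ _ p)   = decode p

  act-decode : ∀ {σ} (p : InΓ G σ) → _≈ₚ_ G (act (decode p)) σ
  act-decode (gen-λ g) x   = ∙-congˡ (trans (∙-congˡ ε⁻¹≈ε) (identityʳ x))
  act-decode (gen-ρ g) x   = identityˡ _
  act-decode gen-ι x       = trans (identityˡ _) (trans (∙-congˡ ε⁻¹≈ε) (identityʳ _))
  act-decode gen-id x      = trans (identityˡ _) (trans (∙-congˡ ε⁻¹≈ε) (identityʳ _))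
  act-decode (gen-∘ {σ} {τ} p q) x = begin
    to (act (_∙W_ G (decode p) (decode q))) x   ≈⟨ act-∙ (decode p) (decode q) x ⟩
    to (act (decode p)) (to (act (decode q)) x) ≈⟨ to-cong (act (decode p)) (act-decode q x) ⟩
    to (act (decode p)) (to τ x)                ≈⟨ act-decode p (to τ x) ⟩
    to σ (to τ x)                               ∎
  act-decode (gen-inv {σ} p) x =
    trans (act-⁻¹ (decode p) x) (from-resp-≈ₚ (act (decode p)) σ (act-decode p) x)
  act-decode (gen-≈ σ≈τ p) x = trans (act-decode p x) (σ≈τ x)

module Isomorphism {c ℓ : Level} (G : Group c ℓ) (¬EA : ¬ IsElementaryAbelian2 G) where
  open Group G using (sym; trans)
  open WreathAction G
  open GroupMorphisms (Γ G) (WreathModZ G)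

  decodeΓ : Σ (Perm G) (InΓ G) → W G
  decodeΓ (_ , p) = decode p

  decode-≈ : ∀ {σ} (p : InΓ G σ) w → _≈ₚ_ G σ (act w) →
             InZ G (_∙W_ G (_⁻¹W G (decode p)) w)
  decode-≈ p w σ≈w = same-action⇒Z ¬EA (decode p) w λ x → trans (act-decode p x) (σ≈w x)

  -- In particular decodeΓ lands on a well-defined class; the product, unit and
  -- inverse are decoded by the corresponding wreath operations on the nose.
  decode-refl : ∀ {σ} (p : InΓ G σ) → InZ G (_∙W_ G (_⁻¹W G (decode p)) (decode p))
  decode-refl p = decode-≈ p (decode p) λ x → sym (act-decode p x)

  decode-injective : ∀ {σ τ} (p : InΓ G σ) (q : InΓ G τ) →
                     InZ G (_∙W_ G (_⁻¹W G (decode p)) (decode q)) → _≈ₚ_ G σ τ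
  decode-injective p q z x =
    trans (sym (act-decode p x)) (trans (Z⇒same-action (decode p) (decode q) z x) (act-decode q x))

  decodeΓ-iso : IsGroupIsomorphism decodeΓ
  decodeΓ-iso = record
    { isGroupMonomorphism = record
      { isGroupHomomorphism = record
        { isMonoidHomomorphism = record
          { isMagmaHomomorphism = record
            { isRelHomomorphism = record
              { cong = λ { {_ , p} {_ , q} σ≈τ → decode-≈ p (decode q) λ x → trans (σ≈τ x) (sym (act-decode q x)) } }
            ; homo = λ { (_ , p) (_ , q) → decode-refl (gen-∘ p q) }
            }
          ; ε-homo = decode-refl (gen-id {G = G})
          }
        ; ⁻¹-homo = λ { (_ , p) → decode-refl (gen-inv p) }
        }
      ; injective = λ { {_ , p} {_ , q} → decode-injective p q }
      }
    ; surjective = λ w → (act w , act-InΓ w) , λ { {_ , p} σ≈act-w → decode-≈ p w σ≈act-w }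
    }

lemma2p1 : ∀ {c ℓ : Level} (G : Group c ℓ) → Finite G → ¬ IsElementaryAbelian2 G →
    ∃ λ f → GroupMorphisms.IsGroupIsomorphism (Γ G) (WreathModZ G) f
lemma2p1 G _ ¬EA = Isomorphism.decodeΓ G ¬EA , Isomorphism.decodeΓ-iso G ¬EA
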